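{- Let $s\ge2$, $(a_1,\dots,a_s)\in\mathbb Z_{>0}^s$ and $\lambda(a_1,\dots,a_s)=(l_1,\dots,l_s)$. Then for every $k\ge2$ and all indices $1\le i_1<i_2<\dots<i_k\le s$, $$\mathrm{lcm}(a_{i_1},\dots,a_{i_k})=\frac{a_{i_1}\cdots a_{i_k}}{l_{i_1}\cdots l_{i_k}}\,\mathrm{lcm}(l_{i_1},\dots,l_{i_k}).$$
   Context: For $s\ge2$ define $\lambda:\mathbb Z_{>0}^s\to\mathbb Z_{>0}^s$ by $\lambda(a_1,\dots,a_s)=(l_1,\dots,l_s)$ with $l_i=\mathrm{lcm}\{\gcd(a_j,a_i): 1\le j\le s,\ j\ne i\}$. -}

module Defs where

open import Data.Nat using (ℕ; _*_)
open import Data.Nat.GCD using (gcd)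
open import Data.Nat.LCM using (lcm)
open import Data.Fin using (Fin; _≟_)
open import Data.List using (List; []; _∷_; foldr; map; filter; allFin)
open import Data.Nat.ListAction using (product)
open import Relation.Nullary using (¬?)

lcmList : List ℕ → ℕ
lcmList = foldr lcm 1

lambdaMap : ∀ {s} → (Fin s → ℕ) → (Fin s → ℕ)
lambdaMap {s} a i = lcmList (map (λ j → gcd (a j) (a i)) (filter (λ j → ¬? (j ≟ i)) (allFin s)))

prodFin : ∀ {k} → (Fin k → ℕ) → ℕ
prodFin {k} f = product (map f (allFin k))

lcmFin : ∀ {k} → (Fin k → ℕ) → ℕ
lcmFin {k} f = lcmList (map f (allFin k))

{-# OPTIONS --safe #-}
-- For i ≠ j we have gcd a_i a_j ∣ l_i ∣ a_i, hence gcd l_i l_j = gcd a_i a_j.  The identity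
-- lcm A · ∏ L = ∏ A · lcm L holds for any two families with the same pairwise gcds, by
-- induction: since gcd distributes over lcm, gcd (A₀, lcm A') = lcm_q gcd (A₀, A_q) equals
-- gcd (L₀, lcm L'), and gcd m n · lcm m n = m n then turns the inductive hypothesis
-- (multiplied by A₀ L₀) into the claim for A₀ and L₀ added.
module Submission where

open import Defs
open import Data.Nat using (ℕ; _*_; _≤_; _<_)
open import Data.Fin using (Fin) renaming (_<_ to _<ᶠ_)
open import Function using (_∘_)
open import Function.Base using (id)
open import Relation.Binary.PropositionalEquality using (_≡_)

open import Data.Nat.Base using (zero; suc; NonZero; ≢-nonZero)
open import Data.Nat.Properties using (*-comm; *-assoc; *-cancelˡ-≡)
open import Data.Nat.Divisibility using (_∣_; ∣-antisym; ∣-trans; *-pres-∣; *-cancelˡ-∣; 1∣_)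
open import Data.Nat.GCD
  using (gcd; gcd-greatest; gcd[m,n]∣m; gcd[m,n]∣n; gcd[m,n]≢0; gcd-comm; gcd-identityˡ; gcd-zeroʳ
        ; c*gcd[m,n]≡gcd[cm,cn])
open import Data.Nat.LCM using (lcm; lcm-least; m∣lcm[m,n]; n∣lcm[m,n]; gcd*lcm)
open import Data.Nat.ListAction using (product)
open import Data.Nat.Solver using (module +-*-Solver)
open import Data.Fin.Base using (zero; suc)
open import Data.Fin.Properties using (suc-injective; <-cmp; <⇒≢; _≟_)
open import Data.List.Base using ([]; _∷_; map; filter; allFin)
open import Data.List.Properties using (map-tabulate; map-∘; map-cong)
open import Data.List.Relation.Unary.All using (All; []; _∷_; universal)
open import Data.List.Relation.Unary.All.Properties using (map⁺)
open import Data.List.Relation.Unary.Any using (here; there)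
open import Data.List.Membership.Propositional using (_∈_)
open import Data.List.Membership.Propositional.Properties using (∈-map⁺; ∈-filter⁺; ∈-allFin)
open import Data.Sum.Base using (inj₁)
open import Relation.Nullary using (¬?; contradiction)
open import Relation.Binary.Definitions using (tri<; tri≈; tri>)
open import Relation.Binary.PropositionalEquality
  using (_≢_; _≗_; refl; sym; trans; cong; cong₂; subst; ≢-sym; module ≡-Reasoning)

open +-*-Solver using (solve; _:*_; _:=_)

∣c*m∣c*n⇒∣c*gcd[m,n] : ∀ {d} c {m n} → d ∣ c * m → d ∣ c * n → d ∣ c * gcd m n
∣c*m∣c*n⇒∣c*gcd[m,n] c {m} {n} d∣cm d∣cn =
  subst (_ ∣_) (sym (c*gcd[m,n]≡gcd[cm,cn] c m n)) (gcd-greatest d∣cm d∣cn)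

gcd-distribˡ-lcm : ∀ x y z → gcd x (lcm y z) ≡ lcm (gcd x y) (gcd x z)
gcd-distribˡ-lcm zero y z = begin
  gcd 0 (lcm y z)                ≡⟨ gcd-identityˡ (lcm y z) ⟩
  lcm y z                        ≡⟨ sym (cong₂ lcm (gcd-identityˡ y) (gcd-identityˡ z)) ⟩
  lcm (gcd 0 y) (gcd 0 z)        ∎
  where open ≡-Reasoning
gcd-distribˡ-lcm x@(suc _) y z = ∣-antisym d∣lcm[u,v] (lcm-least u∣d v∣d)
  where
  u v w d : ℕ
  u = gcd x y
  v = gcd x z
  w = gcd u v
  d = gcd x (lcm y z)
  instance
    w≢0 : NonZero w
    w≢0 = ≢-nonZero (gcd[m,n]≢0 u v (inj₁ (gcd[m,n]≢0 x y (inj₁ λ ()))))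
  d∣x : d ∣ x
  d∣x = gcd[m,n]∣m x (lcm y z)
  w∣v : w ∣ v
  w∣v = gcd[m,n]∣n u v
  w∣y : w ∣ y
  w∣y = ∣-trans (gcd[m,n]∣m u v) (gcd[m,n]∣n x y)
  w∣gcd[y,z] : w ∣ gcd y z
  w∣gcd[y,z] = gcd-greatest w∣y (∣-trans w∣v (gcd[m,n]∣n x z))
  -- w * d divides v * u = w * lcm u v, hence d ∣ lcm u v after cancelling w.
  wd∣y*z : w * d ∣ y * z
  wd∣y*z = subst (w * d ∣_) (gcd*lcm y z) (*-pres-∣ w∣gcd[y,z] (gcd[m,n]∣n x (lcm y z)))
  wd∣y*v : w * d ∣ y * v
  wd∣y*v = ∣c*m∣c*n⇒∣c*gcd[m,n] y (*-pres-∣ w∣y d∣x) wd∣y*z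
  wd∣v*u : w * d ∣ v * u
  wd∣v*u = ∣c*m∣c*n⇒∣c*gcd[m,n] v (*-pres-∣ w∣v d∣x) (subst (w * d ∣_) (*-comm y v) wd∣y*v)
  d∣lcm[u,v] : d ∣ lcm u v
  d∣lcm[u,v] = *-cancelˡ-∣ w (subst (w * d ∣_) (trans (*-comm v u) (sym (gcd*lcm u v))) wd∣v*u)
  u∣d : u ∣ d
  u∣d = gcd-greatest (gcd[m,n]∣m x y) (∣-trans (gcd[m,n]∣n x y) (m∣lcm[m,n] y z))
  v∣d : v ∣ d
  v∣d = gcd-greatest (gcd[m,n]∣m x z) (∣-trans (gcd[m,n]∣n x z) (n∣lcm[m,n] y z))

gcd-lcmList : ∀ x xs → gcd x (lcmList xs) ≡ lcmList (map (gcd x) xs)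
gcd-lcmList x []       = gcd-zeroʳ x
gcd-lcmList x (y ∷ ys) =
  trans (gcd-distribˡ-lcm x y (lcmList ys)) (cong (lcm (gcd x y)) (gcd-lcmList x ys))

∈⇒∣lcmList : ∀ {x xs} → x ∈ xs → x ∣ lcmList xs
∈⇒∣lcmList {x} {_ ∷ ys} (here refl) = m∣lcm[m,n] x (lcmList ys)
∈⇒∣lcmList {x} {y ∷ _}  (there x∈ys) = ∣-trans (∈⇒∣lcmList x∈ys) (n∣lcm[m,n] y _)

lcmList-least : ∀ {c xs} → All (_∣ c) xs → lcmList xs ∣ c
lcmList-least {c} []             = 1∣ c
lcmList-least     (x∣c ∷ xs∣c) = lcm-least x∣c (lcmList-least xs∣c)

map-allFin-suc : ∀ {A : Set} {k} (f : Fin (suc k) → A) →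
  map f (allFin (suc k)) ≡ f zero ∷ map (f ∘ suc) (allFin k)
map-allFin-suc f =
  cong (f zero ∷_) (trans (map-tabulate suc f) (sym (map-tabulate id (f ∘ suc))))

lcmFin-suc : ∀ {k} (f : Fin (suc k) → ℕ) → lcmFin f ≡ lcm (f zero) (lcmFin (f ∘ suc))
lcmFin-suc f = cong lcmList (map-allFin-suc f)

prodFin-suc : ∀ {k} (f : Fin (suc k) → ℕ) → prodFin f ≡ f zero * prodFin (f ∘ suc)
prodFin-suc f = cong product (map-allFin-suc f)

lcmFin-cong : ∀ {k} {f g : Fin k → ℕ} → f ≗ g → lcmFin f ≡ lcmFin g
lcmFin-cong {k} f≗g = cong lcmList (map-cong f≗g (allFin k))

gcd-lcmFin : ∀ {k} x (f : Fin k → ℕ) → gcd x (lcmFin f) ≡ lcmFin (gcd x ∘ f)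
gcd-lcmFin {k} x f = trans (gcd-lcmList x (map f (allFin k))) (cong lcmList (sym (map-∘ (allFin k))))

lcm*[l*P]≡[a*Q]*lcm : ∀ a l A Λ P Q → gcd a A ≡ gcd l Λ → A * P ≡ Q * Λ →
  lcm a A * (l * P) ≡ (a * Q) * lcm l Λ
lcm*[l*P]≡[a*Q]*lcm zero        l A Λ P Q _      _     = refl
lcm*[l*P]≡[a*Q]*lcm a@(suc _) l A Λ P Q gcd≡ A*P≡Q*Λ = *-cancelˡ-≡ _ _ g (begin
  g * (lcm a A * (l * P))       ≡⟨ sym (*-assoc g _ _) ⟩
  (g * lcm a A) * (l * P)       ≡⟨ cong (_* (l * P)) (gcd*lcm a A) ⟩
  (a * A) * (l * P)             ≡⟨ solve 4 (λ a A l P → (a :* A) :* (l :* P) := (a :* l) :* (A :* P)) refl a A l P ⟩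
  (a * l) * (A * P)             ≡⟨ cong ((a * l) *_) A*P≡Q*Λ ⟩
  (a * l) * (Q * Λ)             ≡⟨ solve 4 (λ a l Q Λ → (a :* l) :* (Q :* Λ) := (a :* Q) :* (l :* Λ)) refl a l Q Λ ⟩
  (a * Q) * (l * Λ)             ≡⟨ cong ((a * Q) *_) (sym (gcd*lcm l Λ)) ⟩
  (a * Q) * (gcd l Λ * lcm l Λ) ≡⟨ cong (λ h → (a * Q) * (h * lcm l Λ)) (sym gcd≡) ⟩
  (a * Q) * (g * lcm l Λ)       ≡⟨ solve 3 (λ X g Y → X :* (g :* Y) := g :* (X :* Y)) refl (a * Q) g (lcm l Λ) ⟩
  g * ((a * Q) * lcm l Λ)       ∎)
  where
  open ≡-Reasoning
  g : ℕ
  g = gcd a A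
  instance
    g≢0 : NonZero g
    g≢0 = ≢-nonZero (gcd[m,n]≢0 a A (inj₁ λ ()))

lcmFin*prodFin≡prodFin*lcmFin : ∀ {k} (A L : Fin k → ℕ) →
  (∀ {p q} → p ≢ q → gcd (A p) (A q) ≡ gcd (L p) (L q)) →
  lcmFin A * prodFin L ≡ prodFin A * lcmFin L
lcmFin*prodFin≡prodFin*lcmFin {zero}  A L _    = refl
lcmFin*prodFin≡prodFin*lcmFin {suc k} A L gcd≡
  rewrite lcmFin-suc A | lcmFin-suc L | prodFin-suc A | prodFin-suc L =
  lcm*[l*P]≡[a*Q]*lcm (A zero) (L zero) _ _ _ _ gcd-head≡
    (lcmFin*prodFin≡prodFin*lcmFin (A ∘ suc) (L ∘ suc) (λ p≢q → gcd≡ (p≢q ∘ suc-injective)))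
  where
  open ≡-Reasoning
  gcd-head≡ : gcd (A zero) (lcmFin (A ∘ suc)) ≡ gcd (L zero) (lcmFin (L ∘ suc))
  gcd-head≡ = begin
    gcd (A zero) (lcmFin (A ∘ suc))  ≡⟨ gcd-lcmFin (A zero) (A ∘ suc) ⟩
    lcmFin (gcd (A zero) ∘ A ∘ suc)  ≡⟨ lcmFin-cong (λ p → gcd≡ {zero} {suc p} λ ()) ⟩
    lcmFin (gcd (L zero) ∘ L ∘ suc)  ≡⟨ sym (gcd-lcmFin (L zero) (L ∘ suc)) ⟩
    gcd (L zero) (lcmFin (L ∘ suc))  ∎

lambdaMap∣ : ∀ {s} (a : Fin s → ℕ) i → lambdaMap a i ∣ a i
lambdaMap∣ {s} a i =
  lcmList-least (map⁺ (universal (λ j → gcd[m,n]∣n (a j) (a i)) (filter (λ j → ¬? (j ≟ i)) (allFin s))))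

gcd∣lambdaMap : ∀ {s} (a : Fin s → ℕ) {i j} → j ≢ i → gcd (a j) (a i) ∣ lambdaMap a i
gcd∣lambdaMap a {i} {j} j≢i = ∈⇒∣lcmList (∈-map⁺ (λ j → gcd (a j) (a i)) (∈-filter⁺ _ (∈-allFin j) j≢i))

gcd-lambdaMap : ∀ {s} (a : Fin s → ℕ) {i j} → i ≢ j →
  gcd (a i) (a j) ≡ gcd (lambdaMap a i) (lambdaMap a j)
gcd-lambdaMap a {i} {j} i≢j = ∣-antisym
  (gcd-greatest (subst (_∣ lambdaMap a i) (gcd-comm (a j) (a i)) (gcd∣lambdaMap a (≢-sym i≢j)))
                (gcd∣lambdaMap a i≢j))
  (gcd-greatest (∣-trans (gcd[m,n]∣m _ (lambdaMap a j)) (lambdaMap∣ a i))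
                (∣-trans (gcd[m,n]∣n (lambdaMap a i) _) (lambdaMap∣ a j)))

strictMono⇒≢ : ∀ {k s} (ι : Fin k → Fin s) → (∀ p q → p <ᶠ q → ι p <ᶠ ι q) →
  ∀ {p q} → p ≢ q → ι p ≢ ι q
strictMono⇒≢ ι mono {p} {q} p≢q with <-cmp p q
... | tri< p<q _ _ = <⇒≢ (mono p q p<q)
... | tri≈ _ p≡q _ = contradiction p≡q p≢q
... | tri> _ _ q<p = ≢-sym (<⇒≢ (mono q p q<p))

proposition8 : (s : ℕ) → 2 ≤ s → (a : Fin s → ℕ) → (∀ i → 0 < a i) →
    (k : ℕ) → 2 ≤ k → (ι : Fin k → Fin s) → (∀ p q → p <ᶠ q → ι p <ᶠ ι q) →
    lcmFin (a ∘ ι) * prodFin (lambdaMap a ∘ ι) ≡ prodFin (a ∘ ι) * lcmFin (lambdaMap a ∘ ι)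
proposition8 _ _ a _ _ _ ι ι-mono =
  lcmFin*prodFin≡prodFin*lcmFin (a ∘ ι) (lambdaMap a ∘ ι)
    (λ p≢q → gcd-lambdaMap a (strictMono⇒≢ ι ι-mono p≢q))
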